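{- $\mathsf{IQ}^{*}$ is interpretable in $\mathsf{IQ}^{+}$.
   Context: Numerals: $\overline0\equiv0$, $\overline{n+1}\equiv\mathrm S\overline n$. Let $B$ be the set of axioms $\forall xy\,[x\neq y\to\mathrm Sx\neq\mathrm Sy]$, $\forall x\,[\mathrm Sx\neq 0]$, $\forall x\,[x+0=x]$, $\forall xy\,[x+\mathrm Sy=\mathrm S(x+y)]$, $\forall x\,[x\times 0=0]$, $\forall xy\,[x\times\mathrm Sy=x\times y+x]$. $\mathsf{IQ}^{*}$ is the theory in language $\{0,\mathrm S,+,\times\}$ with axioms $B$ and the schema $\forall x\,[x\leq_{\mathsf l}\overline{n}\to\bigvee_{k\leq n}x=\overline{k}]$ for each natural number $n$, where $x\leq_{\mathsf l}y$ abbreviates $\exists z\,[z+x=y]$. $\mathsf{IQ}^{+}$ is the theory in language $\{0,\mathrm S,+,\times,\leq\}$ with axioms $B$, the schema $\forall x\,[x\leq\overline{n}\leftrightarrow\bigvee_{k\leq n}x=\overline{k}]$ for each natural number $n$, and $\forall xyz\,[(x+y)+z=x+(y+z)]$, $\forall xyz\,[x(y+z)=xy+xz]$, $\forall xyz\,[(xy)z=x(yz)]$. Interpretability: an $\mathcal L_1$-theory $S$ is interpretable in an $\mathcal L_2$-theory $T$ if there is a (possibly multi-dimensional, parameter-free, one-piece) relative translation (domain formula, formulas for relation symbols including equality, graphs of function symbols, constants; quantifiers relativized to the domain) such that $T$ proves nonemptiness of the domain, totality and uniqueness of the translated functions and constants on the domain, and the translations of all axioms of $S$ (plus equality axioms if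 equality is not translated as equality). -}

module Defs where

open import Data.Nat using (ℕ; zero; suc; _+_; _*_; _≤_)
open import Data.Fin using (Fin; zero; suc; combine; remQuot)
open import Data.Vec using (Vec; []; _∷_)
open import Data.List using (List; []; _∷_; map)
open import Data.List.Membership.Propositional using (_∈_)
open import Data.Product using (Σ; _×_; _,_)

-- First-order syntax (de Bruijn, scoped: Formula R n has n free variables,
-- var zero = most recently bound variable).
-- Function symbols 0, S, +, × are common to both languages.

data Fun : ℕ → Set where
  fzero  : Fun 0
  fsucc  : Fun 1
  fplus  : Fun 2
  ftimes : Fun 2

data Term (n : ℕ) : Set where
  var : Fin n → Term n
  app : ∀ {k} → Fun k → Vec (Term n) k → Term n

data Rel₁ : ℕ → Set where      -- language {0,S,+,×}: none

data Rel₂ : ℕ → Set where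
  rleq : Rel₂ 2

infix  5 _≐_
infixr 4 _∧'_ _∨'_
infixr 3 _⇒_

data Formula (R : ℕ → Set) (n : ℕ) : Set where
  ⊥'   : Formula R n
  _≐_  : Term n → Term n → Formula R n
  rel  : ∀ {k} → R k → Vec (Term n) k → Formula R n
  _⇒_  : Formula R n → Formula R n → Formula R n
  _∧'_ : Formula R n → Formula R n → Formula R n
  _∨'_ : Formula R n → Formula R n → Formula R n
  ∀'   : Formula R (suc n) → Formula R n
  ∃'   : Formula R (suc n) → Formula R n

¬' : ∀ {R n} → Formula R n → Formula R n
¬' φ = φ ⇒ ⊥'

⊤' : ∀ {R n} → Formula R n
⊤' = ⊥' ⇒ ⊥'

_⇔'_ : ∀ {R n} → Formula R n → Formula R n → Formula R n
φ ⇔' ψ = (φ ⇒ ψ) ∧' (ψ ⇒ φ)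

mutual
  substT : ∀ {n m} → (Fin n → Term m) → Term n → Term m
  substT σ (var i)    = σ i
  substT σ (app f ts) = app f (substTs σ ts)

  substTs : ∀ {n m k} → (Fin n → Term m) → Vec (Term n) k → Vec (Term m) k
  substTs σ []       = []
  substTs σ (t ∷ ts) = substT σ t ∷ substTs σ ts

liftS : ∀ {n m} → (Fin n → Term m) → Fin (suc n) → Term (suc m)
liftS σ zero    = var zero
liftS σ (suc i) = substT (λ j → var (suc j)) (σ i)

substF : ∀ {R n m} → (Fin n → Term m) → Formula R n → Formula R m
substF σ ⊥'         = ⊥'
substF σ (s ≐ t)    = substT σ s ≐ substT σ t
substF σ (rel r ts) = rel r (substTs σ ts)
substF σ (φ ⇒ ψ)    = substF σ φ ⇒ substF σ ψ
substF σ (φ ∧' ψ)   = substF σ φ ∧' substF σ ψ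
substF σ (φ ∨' ψ)   = substF σ φ ∨' substF σ ψ
substF σ (∀' φ)     = ∀' (substF (liftS σ) φ)
substF σ (∃' φ)     = ∃' (substF (liftS σ) φ)

renameF : ∀ {R n m} → (Fin n → Fin m) → Formula R n → Formula R m
renameF ρ = substF (λ i → var (ρ i))

wkF : ∀ {R n} → Formula R n → Formula R (suc n)
wkF = renameF suc

sub0 : ∀ {n} → Term n → Fin (suc n) → Term n
sub0 t zero    = t
sub0 t (suc i) = var i

module _ {R : ℕ → Set} (T : Formula R 0 → Set) where

  data Deriv : ∀ {n} → List (Formula R n) → Formula R n → Set where
    hyp    : ∀ {n Γ} {φ : Formula R n} → φ ∈ Γ → Deriv Γ φ
    axiom  : ∀ {n} {Γ : List (Formula R n)} {ψ} → T ψ → Deriv Γ (renameF (λ ()) ψ)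
    raa    : ∀ {n Γ} {φ : Formula R n} → Deriv (¬' φ ∷ Γ) ⊥' → Deriv Γ φ
    ⇒I     : ∀ {n Γ} {φ ψ : Formula R n} → Deriv (φ ∷ Γ) ψ → Deriv Γ (φ ⇒ ψ)
    ⇒E     : ∀ {n Γ} {φ ψ : Formula R n} → Deriv Γ (φ ⇒ ψ) → Deriv Γ φ → Deriv Γ ψ
    ∧I     : ∀ {n Γ} {φ ψ : Formula R n} → Deriv Γ φ → Deriv Γ ψ → Deriv Γ (φ ∧' ψ)
    ∧E₁    : ∀ {n Γ} {φ ψ : Formula R n} → Deriv Γ (φ ∧' ψ) → Deriv Γ φ
    ∧E₂    : ∀ {n Γ} {φ ψ : Formula R n} → Deriv Γ (φ ∧' ψ) → Deriv Γ ψ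
    ∨I₁    : ∀ {n Γ} {φ ψ : Formula R n} → Deriv Γ φ → Deriv Γ (φ ∨' ψ)
    ∨I₂    : ∀ {n Γ} {φ ψ : Formula R n} → Deriv Γ ψ → Deriv Γ (φ ∨' ψ)
    ∨E     : ∀ {n Γ} {φ ψ χ : Formula R n} → Deriv Γ (φ ∨' ψ) →
             Deriv (φ ∷ Γ) χ → Deriv (ψ ∷ Γ) χ → Deriv Γ χ
    ∀I     : ∀ {n Γ} {φ : Formula R (suc n)} → Deriv (map wkF Γ) φ → Deriv Γ (∀' φ)
    ∀E     : ∀ {n Γ} {φ : Formula R (suc n)} → Deriv Γ (∀' φ) →
             (t : Term n) → Deriv Γ (substF (sub0 t) φ)
    ∃I     : ∀ {n Γ} {φ : Formula R (suc n)} (t : Term n) →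
             Deriv Γ (substF (sub0 t) φ) → Deriv Γ (∃' φ)
    ∃E     : ∀ {n Γ} {φ : Formula R (suc n)} {ψ : Formula R n} → Deriv Γ (∃' φ) →
             Deriv (φ ∷ map wkF Γ) (wkF ψ) → Deriv Γ ψ
    ≐refl  : ∀ {n Γ} (t : Term n) → Deriv Γ (t ≐ t)
    ≐subst : ∀ {n Γ} {s t : Term n} (φ : Formula R (suc n)) → Deriv Γ (s ≐ t) →
             Deriv Γ (substF (sub0 s) φ) → Deriv Γ (substF (sub0 t) φ)

_⊢_ : ∀ {R} → (Formula R 0 → Set) → Formula R 0 → Set
T ⊢ φ = Deriv T [] φ

𝟎 : ∀ {n} → Term n
𝟎 = app fzero []

𝐒 : ∀ {n} → Term n → Term n
𝐒 t = app fsucc (t ∷ [])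

infixl 7 _⊗_
infixl 6 _⊕_

_⊕_ : ∀ {n} → Term n → Term n → Term n
s ⊕ t = app fplus (s ∷ t ∷ [])

_⊗_ : ∀ {n} → Term n → Term n → Term n
s ⊗ t = app ftimes (s ∷ t ∷ [])

num : ∀ {m} → ℕ → Term m
num zero    = 𝟎
num (suc n) = 𝐒 (num n)

⋁≤ : ∀ {R m} → (ℕ → Formula R m) → ℕ → Formula R m
⋁≤ f zero    = f zero
⋁≤ f (suc n) = ⋁≤ f n ∨' f (suc n)

v0 : ∀ {n} → Term (suc n)
v0 = var zero
v1 : ∀ {n} → Term (suc (suc n))
v1 = var (suc zero)
v2 : ∀ {n} → Term (suc (suc (suc n)))
v2 = var (suc (suc zero))
v3 : ∀ {n} → Term (suc (suc (suc (suc n))))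
v3 = var (suc (suc (suc zero)))

data B {R : ℕ → Set} : Formula R 0 → Set where
  b1 : B (∀' (∀' (¬' (v1 ≐ v0) ⇒ ¬' (𝐒 v1 ≐ 𝐒 v0))))
  b2 : B (∀' (¬' (𝐒 v0 ≐ 𝟎)))
  b3 : B (∀' (v0 ⊕ 𝟎 ≐ v0))
  b4 : B (∀' (∀' (v1 ⊕ 𝐒 v0 ≐ 𝐒 (v1 ⊕ v0))))
  b5 : B (∀' (v0 ⊗ 𝟎 ≐ 𝟎))
  b6 : B (∀' (∀' (v1 ⊗ 𝐒 v0 ≐ v1 ⊗ v0 ⊕ v1)))

-- IQ* : B + ∀x [x ≤ₗ n̄ → ⋁_{k≤n} x = k̄],  where x ≤ₗ y := ∃z [z + x = y]
data IQstar : Formula Rel₁ 0 → Set where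
  ax-B : ∀ {φ} → B φ → IQstar φ
  ax-≤ : ∀ n → IQstar (∀' (∃' (v0 ⊕ v1 ≐ num n) ⇒ ⋁≤ (λ k → v0 ≐ num k) n))

data IQplus : Formula Rel₂ 0 → Set where
  ax-B     : ∀ {φ} → B φ → IQplus φ
  ax-≤     : ∀ n → IQplus (∀' (rel rleq (v0 ∷ num n ∷ []) ⇔' ⋁≤ (λ k → v0 ≐ num k) n))
  ax-+assoc : IQplus (∀' (∀' (∀' ((v2 ⊕ v1) ⊕ v0 ≐ v2 ⊕ (v1 ⊕ v0)))))
  ax-distr  : IQplus (∀' (∀' (∀' (v2 ⊗ (v1 ⊕ v0) ≐ v2 ⊗ v1 ⊕ v2 ⊗ v0))))
  ax-×assoc : IQplus (∀' (∀' (∀' ((v2 ⊗ v1) ⊗ v0 ≐ v2 ⊗ (v1 ⊗ v0)))))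

data EqAx : Formula Rel₁ 0 → Set where
  eq-refl  : EqAx (∀' (v0 ≐ v0))
  eq-sym   : EqAx (∀' (∀' (v1 ≐ v0 ⇒ v0 ≐ v1)))
  eq-trans : EqAx (∀' (∀' (∀' (v2 ≐ v1 ⇒ v1 ≐ v0 ⇒ v2 ≐ v0))))
  eq-S     : EqAx (∀' (∀' (v1 ≐ v0 ⇒ 𝐒 v1 ≐ 𝐒 v0)))
  eq-+     : EqAx (∀' (∀' (∀' (∀' (v3 ≐ v2 ⇒ v1 ≐ v0 ⇒ v3 ⊕ v1 ≐ v2 ⊕ v0)))))
  eq-×     : EqAx (∀' (∀' (∀' (∀' (v3 ≐ v2 ⇒ v1 ≐ v0 ⇒ v3 ⊗ v1 ≐ v2 ⊗ v0)))))

-- A dimension-d translation works with "blocks" of d variables: a formula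
-- in context k * d has k blocks; block b consists of the variables
-- combine b j (j : Fin d).  Block 0 is the most recently bound block.

∀^ : ∀ {R k} d → Formula R (d + k) → Formula R k
∀^ zero    φ = φ
∀^ (suc d) φ = ∀^ d (∀' φ)

∃^ : ∀ {R k} d → Formula R (d + k) → Formula R k
∃^ zero    φ = φ
∃^ (suc d) φ = ∃^ d (∃' φ)

⋀ : ∀ {R n d} → (Fin d → Formula R n) → Formula R n
⋀ {d = zero}  f = ⊤'
⋀ {d = suc d} f = f zero ∧' ⋀ (λ j → f (suc j))

module Blocks (d : ℕ) where
  ∀ᵇ : ∀ m → Formula Rel₂ (suc m * d) → Formula Rel₂ (m * d)
  ∀ᵇ m = ∀^ d
  ∃ᵇ : ∀ m → Formula Rel₂ (suc m * d) → Formula Rel₂ (m * d)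
  ∃ᵇ m = ∃^ d

  -- plug blocks: block b of φ becomes block σ b
  inst : ∀ k m → Formula Rel₂ (k * d) → (Fin k → Fin m) → Formula Rel₂ (m * d)
  inst k m φ σ = renameF (λ v → let (b , j) = remQuot {k} d v in combine (σ b) j) φ

-- Parameter-free one-piece translation data.
-- Graph formulas: block 0 = value, block (i+1) = i-th argument.
-- E: block 0 and block 1 are the two compared tuples.
record Translation : Set where
  field
    dim   : ℕ
    dim≥1 : 1 ≤ dim
    δ     : Formula Rel₂ (1 * dim)
    E     : Formula Rel₂ (2 * dim)
    Fz    : Formula Rel₂ (1 * dim)
    FS    : Formula Rel₂ (2 * dim)
    Fp    : Formula Rel₂ (3 * dim)
    Ft    : Formula Rel₂ (3 * dim)

module Translate (I : Translation) where
  open Translation I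
  open Blocks dim

  bx0 : ∀ {m} → Fin (suc m)
  bx0 = zero
  bx1 : ∀ {m} → Fin (suc (suc m))
  bx1 = suc zero
  bx2 : ∀ {m} → Fin (suc (suc (suc m)))
  bx2 = suc (suc zero)
  bx3 : ∀ {m} → Fin (suc (suc (suc (suc m))))
  bx3 = suc (suc (suc zero))

  δat : ∀ m → Fin m → Formula Rel₂ (m * dim)
  δat m b = inst 1 m δ (λ _ → b)

  -- Val t : "block 0 is the value of t", block (i+1) = variable i
  valBin : ∀ {n} → Formula Rel₂ (3 * dim) → Formula Rel₂ (suc n * dim) →
           Formula Rel₂ (suc n * dim) → Formula Rel₂ (suc n * dim)
  valBin {n} F vs vt =
    ∃ᵇ (suc n) (∃ᵇ (suc (suc n)) (δat m bx1 ∧' δat m bx0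
      ∧' inst (suc n) m vs (λ { zero → bx1 ; (suc i) → suc (suc (suc i)) })
      ∧' inst (suc n) m vt (λ { zero → bx0 ; (suc i) → suc (suc (suc i)) })
      ∧' inst 3 m F (λ { zero → bx2 ; (suc zero) → bx1 ; (suc (suc _)) → bx0 })))
    where m = suc (suc (suc n))

  Val : ∀ {n} → Term n → Formula Rel₂ (suc n * dim)
  Val {n} (var i) = ⋀ (λ j → var (combine {suc n} zero j) ≐ var (combine {suc n} (suc i) j))
  Val {n} (app fzero []) = inst 1 (suc n) Fz (λ _ → bx0)
  Val {n} (app fsucc (t ∷ [])) =
    ∃ᵇ (suc n) (δat m bx0
      ∧' inst (suc n) m (Val t) (λ { zero → bx0 ; (suc i) → suc (suc i) })
      ∧' inst 2 m FS (λ { zero → bx1 ; (suc _) → bx0 }))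
    where m = suc (suc n)
  Val {n} (app fplus (s ∷ t ∷ []))  = valBin {n} Fp (Val s) (Val t)
  Val {n} (app ftimes (s ∷ t ∷ [])) = valBin {n} Ft (Val s) (Val t)

  -- translation of formulas; variable i of the source becomes block i
  τ : ∀ {n} → Formula Rel₁ n → Formula Rel₂ (n * dim)
  τ ⊥'       = ⊥'
  τ {n} (s ≐ t)  =
    ∃ᵇ n (∃ᵇ (suc n) (δat m bx1 ∧' δat m bx0
      ∧' inst (suc n) m (Val s) (λ { zero → bx1 ; (suc i) → suc (suc i) })
      ∧' inst (suc n) m (Val t) (λ { zero → bx0 ; (suc i) → suc (suc i) })
      ∧' inst 2 m E (λ { zero → bx1 ; (suc _) → bx0 })))
    where m = suc (suc n)
  τ (rel () _)
  τ (φ ⇒ ψ)  = τ φ ⇒ τ ψ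
  τ (φ ∧' ψ) = τ φ ∧' τ ψ
  τ (φ ∨' ψ) = τ φ ∨' τ ψ
  τ {n} (∀' φ)   = ∀ᵇ n (δat (suc n) bx0 ⇒ τ φ)
  τ {n} (∃' φ)   = ∃ᵇ n (δat (suc n) bx0 ∧' τ φ)

  nonemptySent : Formula Rel₂ 0
  nonemptySent = ∃ᵇ 0 (δat 1 bx0)

  totZero : Formula Rel₂ 0
  totZero = ∃ᵇ 0 (δat 1 bx0 ∧' inst 1 1 Fz (λ _ → bx0))

  uniqZero : Formula Rel₂ 0
  uniqZero = ∀ᵇ 0 (∀ᵇ 1 (δat 2 bx1 ∧' δat 2 bx0 ∧' inst 1 2 Fz (λ _ → bx1) ∧' inst 1 2 Fz (λ _ → bx0)
                      ⇒ inst 2 2 E (λ { zero → bx1 ; (suc _) → bx0 })))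

  -- blocks: 1 = argument x, 0 = value y
  totS : Formula Rel₂ 0
  totS = ∀ᵇ 0 (δat 1 bx0 ⇒ ∃ᵇ 1 (δat 2 bx0 ∧' inst 2 2 FS (λ { zero → bx0 ; (suc _) → bx1 })))

  -- blocks: 2 = x, 1 = y, 0 = y'
  uniqS : Formula Rel₂ 0
  uniqS = ∀ᵇ 0 (∀ᵇ 1 (∀ᵇ 2 (δat 3 bx2 ∧' δat 3 bx1 ∧' δat 3 bx0
            ∧' inst 2 3 FS (λ { zero → bx1 ; (suc _) → bx2 })
            ∧' inst 2 3 FS (λ { zero → bx0 ; (suc _) → bx2 })
            ⇒ inst 2 3 E (λ { zero → bx1 ; (suc _) → bx0 }))))

  -- blocks: 2 = first argument a, 1 = second argument b, 0 = value
  totBin : Formula Rel₂ (3 * dim) → Formula Rel₂ 0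
  totBin F = ∀ᵇ 0 (∀ᵇ 1 (δat 2 bx1 ∧' δat 2 bx0 ⇒
               ∃ᵇ 2 (δat 3 bx0 ∧' inst 3 3 F (λ { zero → bx0 ; (suc zero) → bx2 ; (suc (suc _)) → bx1 }))))

  -- blocks: 3 = a, 2 = b, 1 = y, 0 = y'
  uniqBin : Formula Rel₂ (3 * dim) → Formula Rel₂ 0
  uniqBin F = ∀ᵇ 0 (∀ᵇ 1 (∀ᵇ 2 (∀ᵇ 3 (δat 4 bx3 ∧' δat 4 bx2 ∧' δat 4 bx1 ∧' δat 4 bx0
            ∧' inst 3 4 F (λ { zero → bx1 ; (suc zero) → bx3 ; (suc (suc _)) → bx2 })
            ∧' inst 3 4 F (λ { zero → bx0 ; (suc zero) → bx3 ; (suc (suc _)) → bx2 })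
            ⇒ inst 2 4 E (λ { zero → bx1 ; (suc _) → bx0 })))))

record IsInterpretation (S : Formula Rel₁ 0 → Set) (T : Formula Rel₂ 0 → Set)
                        (I : Translation) : Set where
  open Translation I
  open Translate I
  field
    nonempty  : T ⊢ nonemptySent
    tot-0     : T ⊢ totZero
    uniq-0    : T ⊢ uniqZero
    tot-S     : T ⊢ totS
    uniq-S    : T ⊢ uniqS
    tot-+     : T ⊢ totBin Fp
    uniq-+    : T ⊢ uniqBin Fp
    tot-×     : T ⊢ totBin Ft
    uniq-×    : T ⊢ uniqBin Ft
    axioms    : ∀ φ → S φ → T ⊢ τ φ
    equality  : ∀ φ → EqAx φ → T ⊢ τ φ

Interpretable : (Formula Rel₁ 0 → Set) → (Formula Rel₂ 0 → Set) → Set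
Interpretable S T = Σ Translation (IsInterpretation S T)

-- The interpretation is one-dimensional and translates every symbol by itself; only the
-- domain is restricted, to a cut of the kind used in Solovay's shortening technique.
-- Call c regular if ≤ behaves below c like the order of an initial segment of ℕ, and y
-- hereditary if every x ≤ y is regular; the ≤-schema of IQ⁺ makes every numeral
-- hereditary.  The cut consists of those x with x ≤ z + x whenever z + x is hereditary.
-- It contains 0 and is closed under S; shortening it twice, using associativity of + and
-- of × and distributivity, makes it closed under + and × as well, so it is the domain of
-- an interpretation in which B holds verbatim.  Finally, if x is in the domain and
-- z + x = n̄, then x ≤ n̄ because n̄ is hereditary, and the ≤-schema of IQ⁺ turns this into
-- x = 0̄ ∨ … ∨ x = n̄, which is the ≤ₗ-schema of IQ*.

module Submission where

open import Defs
open import Data.Nat using (ℕ; zero; suc; _*_; _≤_; z≤n; s≤s; _≟_)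
open import Data.Nat.Properties using (≤-refl; ≤-trans; n≤1+n; m≤n⇒m≤1+n; ≤-pred; ≤∧≢⇒<)
open import Data.Fin using (Fin; zero; suc; combine; remQuot)
open import Data.Fin.Properties using (remQuot-combine)
open import Data.Vec using (Vec; []; _∷_)
open import Data.List using (List; []; _∷_)
open import Data.List.Relation.Unary.Any using (here; there)
open import Data.List.Relation.Binary.Subset.Propositional using (_⊆_)
open import Data.List.Relation.Binary.Subset.Propositional.Properties using (map⁺; ∷⁺ʳ)
open import Data.Product using (_,_; proj₁; proj₂)
open import Relation.Binary.PropositionalEquality
open import Relation.Nullary using (yes; no)

Sub : ℕ → ℕ → Set
Sub n m = Fin n → Term m

_∘ˢ_ : ∀ {n m k} → Sub m k → Sub n m → Sub n k
(σ ∘ˢ ρ) i = substT σ (ρ i)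

ren : ∀ {n m} → (Fin n → Fin m) → Sub n m
ren ρ i = var (ρ i)

ext : ∀ {n m} → Term m → Sub n m → Sub (suc n) m
ext t σ zero    = t
ext t σ (suc i) = σ i

wkT : ∀ {n} → Term n → Term (suc n)
wkT = substT (ren suc)

mutual
  substT-cong : ∀ {n m} {σ ρ : Sub n m} → σ ≗ ρ → ∀ t → substT σ t ≡ substT ρ t
  substT-cong e (var i)    = e i
  substT-cong e (app f ts) = cong (app f) (substTs-cong e ts)

  substTs-cong : ∀ {n m k} {σ ρ : Sub n m} → σ ≗ ρ → (ts : Vec (Term n) k) →
                 substTs σ ts ≡ substTs ρ ts
  substTs-cong e []       = refl
  substTs-cong e (t ∷ ts) = cong₂ _∷_ (substT-cong e t) (substTs-cong e ts)

mutual
  substT-∘ : ∀ {n m k} (σ : Sub m k) (ρ : Sub n m) t → substT σ (substT ρ t) ≡ substT (σ ∘ˢ ρ) t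
  substT-∘ σ ρ (var i)    = refl
  substT-∘ σ ρ (app f ts) = cong (app f) (substTs-∘ σ ρ ts)

  substTs-∘ : ∀ {n m k j} (σ : Sub m k) (ρ : Sub n m) (ts : Vec (Term n) j) →
              substTs σ (substTs ρ ts) ≡ substTs (σ ∘ˢ ρ) ts
  substTs-∘ σ ρ []       = refl
  substTs-∘ σ ρ (t ∷ ts) = cong₂ _∷_ (substT-∘ σ ρ t) (substTs-∘ σ ρ ts)

mutual
  substT-id : ∀ {n} (t : Term n) → substT var t ≡ t
  substT-id (var i)    = refl
  substT-id (app f ts) = cong (app f) (substTs-id ts)

  substTs-id : ∀ {n k} (ts : Vec (Term n) k) → substTs var ts ≡ ts
  substTs-id []       = refl
  substTs-id (t ∷ ts) = cong₂ _∷_ (substT-id t) (substTs-id ts)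

substT-sub0-wkT : ∀ {n} (s t : Term n) → substT (sub0 s) (wkT t) ≡ t
substT-sub0-wkT s t = trans (substT-∘ (sub0 s) (ren suc) t) (substT-id t)

substT-liftS-wkT : ∀ {n m} (σ : Sub n m) t → substT (liftS σ) (wkT t) ≡ wkT (substT σ t)
substT-liftS-wkT σ t = trans (substT-∘ (liftS σ) (ren suc) t) (sym (substT-∘ (ren suc) σ t))

substT-num : ∀ {n m} (σ : Sub n m) k → substT σ (num k) ≡ num k
substT-num σ zero    = refl
substT-num σ (suc k) = cong 𝐒 (substT-num σ k)

liftS-cong : ∀ {n m} {σ ρ : Sub n m} → σ ≗ ρ → liftS σ ≗ liftS ρ
liftS-cong e zero    = refl
liftS-cong e (suc i) = cong wkT (e i)

liftS-∘ : ∀ {n m k} (σ : Sub m k) (ρ : Sub n m) → liftS σ ∘ˢ liftS ρ ≗ liftS (σ ∘ˢ ρ)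
liftS-∘ σ ρ zero    = refl
liftS-∘ σ ρ (suc i) = substT-liftS-wkT σ (ρ i)

liftS-id : ∀ {n} → liftS {n} var ≗ var
liftS-id zero    = refl
liftS-id (suc i) = refl

sub0-∘-liftS : ∀ {n m} (t : Term m) (σ : Sub n m) → sub0 t ∘ˢ liftS σ ≗ ext t σ
sub0-∘-liftS t σ zero    = refl
sub0-∘-liftS t σ (suc i) = substT-sub0-wkT t (σ i)

substF-cong : ∀ {R n m} {σ ρ : Sub n m} → σ ≗ ρ → (φ : Formula R n) → substF σ φ ≡ substF ρ φ
substF-cong e ⊥'         = refl
substF-cong e (s ≐ t)    = cong₂ _≐_ (substT-cong e s) (substT-cong e t)
substF-cong e (rel r ts) = cong (rel r) (substTs-cong e ts)
substF-cong e (φ ⇒ ψ)    = cong₂ _⇒_ (substF-cong e φ) (substF-cong e ψ)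
substF-cong e (φ ∧' ψ)   = cong₂ _∧'_ (substF-cong e φ) (substF-cong e ψ)
substF-cong e (φ ∨' ψ)   = cong₂ _∨'_ (substF-cong e φ) (substF-cong e ψ)
substF-cong e (∀' φ)     = cong ∀' (substF-cong (liftS-cong e) φ)
substF-cong e (∃' φ)     = cong ∃' (substF-cong (liftS-cong e) φ)

substF-∘ : ∀ {R n m k} (σ : Sub m k) (ρ : Sub n m) (φ : Formula R n) →
           substF σ (substF ρ φ) ≡ substF (σ ∘ˢ ρ) φ
substF-∘ σ ρ ⊥'         = refl
substF-∘ σ ρ (s ≐ t)    = cong₂ _≐_ (substT-∘ σ ρ s) (substT-∘ σ ρ t)
substF-∘ σ ρ (rel r ts) = cong (rel r) (substTs-∘ σ ρ ts)
substF-∘ σ ρ (φ ⇒ ψ)    = cong₂ _⇒_ (substF-∘ σ ρ φ) (substF-∘ σ ρ ψ)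
substF-∘ σ ρ (φ ∧' ψ)   = cong₂ _∧'_ (substF-∘ σ ρ φ) (substF-∘ σ ρ ψ)
substF-∘ σ ρ (φ ∨' ψ)   = cong₂ _∨'_ (substF-∘ σ ρ φ) (substF-∘ σ ρ ψ)
substF-∘ σ ρ (∀' φ)     = cong ∀' (trans (substF-∘ (liftS σ) (liftS ρ) φ) (substF-cong (liftS-∘ σ ρ) φ))
substF-∘ σ ρ (∃' φ)     = cong ∃' (trans (substF-∘ (liftS σ) (liftS ρ) φ) (substF-cong (liftS-∘ σ ρ) φ))

substF-id : ∀ {R n} (φ : Formula R n) → substF var φ ≡ φ
substF-id ⊥'         = refl
substF-id (s ≐ t)    = cong₂ _≐_ (substT-id s) (substT-id t)
substF-id (rel r ts) = cong (rel r) (substTs-id ts)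
substF-id (φ ⇒ ψ)    = cong₂ _⇒_ (substF-id φ) (substF-id ψ)
substF-id (φ ∧' ψ)   = cong₂ _∧'_ (substF-id φ) (substF-id ψ)
substF-id (φ ∨' ψ)   = cong₂ _∨'_ (substF-id φ) (substF-id ψ)
substF-id (∀' φ)     = cong ∀' (trans (substF-cong liftS-id φ) (substF-id φ))
substF-id (∃' φ)     = cong ∃' (trans (substF-cong liftS-id φ) (substF-id φ))

substF-sub0-liftS : ∀ {R n m} (t : Term m) (σ : Sub n m) (φ : Formula R (suc n)) →
                    substF (sub0 t) (substF (liftS σ) φ) ≡ substF (ext t σ) φ
substF-sub0-liftS t σ φ = trans (substF-∘ (sub0 t) (liftS σ) φ) (substF-cong (sub0-∘-liftS t σ) φ)

⋁≤-cong : ∀ {R m} {f g : ℕ → Formula R m} → (∀ k → f k ≡ g k) → ∀ n → ⋁≤ f n ≡ ⋁≤ g n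
⋁≤-cong e zero    = e zero
⋁≤-cong e (suc n) = cong₂ _∨'_ (⋁≤-cong e n) (e (suc n))

substF-⋁≤ : ∀ {R m m'} (σ : Sub m m') (f : ℕ → Formula R m) n →
            substF σ (⋁≤ f n) ≡ ⋁≤ (λ k → substF σ (f k)) n
substF-⋁≤ σ f zero    = refl
substF-⋁≤ σ f (suc n) = cong (_∨' substF σ (f (suc n))) (substF-⋁≤ σ f n)

wkT-substT : ∀ {n m} (σ : Sub n m) t → wkT (substT σ t) ≡ substT (λ i → wkT (σ i)) t
wkT-substT σ t = substT-∘ (ren suc) σ t

wkT²-substT : ∀ {n m} (σ : Sub n m) t → wkT (wkT (substT σ t)) ≡ substT (λ i → wkT (wkT (σ i))) t
wkT²-substT σ t = trans (cong wkT (wkT-substT σ t)) (wkT-substT (λ i → wkT (σ i)) t)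

-- Introducing the existentially quantified blocks of a translated formula leaves a stuck
-- subformula renameF ρ (Val t) under several substitutions; keeping that stack explicit
-- lets Agda infer the renaming ρ, which is not nameable outside Defs.
infixr 5 _◁_
data Subs : ℕ → ℕ → Set where
  ε   : ∀ {n} → Subs n n
  _◁_ : ∀ {k m n} → Sub m n → Subs k m → Subs k n

substF* : ∀ {R k n} → Subs k n → Formula R k → Formula R n
substF* ε        φ = φ
substF* (σ ◁ τs) φ = substF σ (substF* τs φ)

⟦_⟧ˢ : ∀ {k n} → Subs k n → Sub k n
⟦ ε ⟧ˢ      = var
⟦ σ ◁ τs ⟧ˢ = σ ∘ˢ ⟦ τs ⟧ˢ

substF*-⟦⟧ : ∀ {R k n} (τs : Subs k n) (φ : Formula R k) → substF* τs φ ≡ substF ⟦ τs ⟧ˢ φ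
substF*-⟦⟧ ε        φ = sym (substF-id φ)
substF*-⟦⟧ (σ ◁ τs) φ = trans (cong (substF σ) (substF*-⟦⟧ τs φ)) (substF-∘ σ ⟦ τs ⟧ˢ φ)

substF*-ren : ∀ {R k K n} (τs : Subs K n) {θ : Sub K n} → ⟦ τs ⟧ˢ ≗ θ → (ρ : Fin k → Fin K) (φ : Formula R k) →
              substF* τs (renameF ρ φ) ≡ substF (θ ∘ˢ ren ρ) φ
substF*-ren τs e ρ φ =
  trans (substF*-⟦⟧ τs (renameF ρ φ)) (trans (substF-cong e (renameF ρ φ)) (substF-∘ _ (ren ρ) φ))

⟦sub0◁liftS²⟧ : ∀ {k n} (u₁ u₂ : Term n) (σ : Sub k n) →
                ⟦ sub0 u₂ ◁ liftS (sub0 u₁) ◁ liftS (liftS σ) ◁ ε ⟧ˢ ≗ ext u₂ (ext u₁ σ)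
⟦sub0◁liftS²⟧ u₁ u₂ σ zero          = refl
⟦sub0◁liftS²⟧ u₁ u₂ σ (suc zero)    = substT-sub0-wkT u₂ u₁
⟦sub0◁liftS²⟧ u₁ u₂ σ (suc (suc j)) = begin
  substT (sub0 u₂) (substT (liftS (sub0 u₁)) (wkT (wkT (σ j))))
    ≡⟨ cong (substT (sub0 u₂)) (substT-liftS-wkT (sub0 u₁) (wkT (σ j))) ⟩
  substT (sub0 u₂) (wkT (substT (sub0 u₁) (wkT (σ j))))
    ≡⟨ cong (λ x → substT (sub0 u₂) (wkT x)) (substT-sub0-wkT u₁ (σ j)) ⟩
  substT (sub0 u₂) (wkT (σ j))
    ≡⟨ substT-sub0-wkT u₂ (σ j) ⟩
  σ j ∎
  where open ≡-Reasoning

module Deduction {R : ℕ → Set} (T : Formula R 0 → Set) where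

  infix 2 _⊩_
  _⊩_ : ∀ {n} → List (Formula R n) → Formula R n → Set
  _⊩_ = Deriv T

  weaken : ∀ {n} {Γ Δ : List (Formula R n)} {φ} → Γ ⊆ Δ → Γ ⊩ φ → Δ ⊩ φ
  weaken s (hyp p)        = hyp (s p)
  weaken s (axiom a)      = axiom a
  weaken s (raa d)        = raa (weaken (∷⁺ʳ _ s) d)
  weaken s (⇒I d)         = ⇒I (weaken (∷⁺ʳ _ s) d)
  weaken s (⇒E d e)       = ⇒E (weaken s d) (weaken s e)
  weaken s (∧I d e)       = ∧I (weaken s d) (weaken s e)
  weaken s (∧E₁ d)        = ∧E₁ (weaken s d)
  weaken s (∧E₂ d)        = ∧E₂ (weaken s d)
  weaken s (∨I₁ d)        = ∨I₁ (weaken s d)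
  weaken s (∨I₂ d)        = ∨I₂ (weaken s d)
  weaken s (∨E d e f)     = ∨E (weaken s d) (weaken (∷⁺ʳ _ s) e) (weaken (∷⁺ʳ _ s) f)
  weaken s (∀I d)         = ∀I (weaken (map⁺ wkF s) d)
  weaken s (∀E d t)       = ∀E (weaken s d) t
  weaken s (∃I t d)       = ∃I t (weaken s d)
  weaken s (∃E d e)       = ∃E (weaken s d) (weaken (∷⁺ʳ _ (map⁺ wkF s)) e)
  weaken s (≐refl t)      = ≐refl t
  weaken s (≐subst φ d e) = ≐subst φ (weaken s d) (weaken s e)

  module _ {n : ℕ} where
    #0 : ∀ {Γ : List (Formula R n)} {a} → (a ∷ Γ) ⊩ a
    #0 = hyp (here refl)
    #1 : ∀ {Γ : List (Formula R n)} {a b} → (a ∷ b ∷ Γ) ⊩ b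
    #1 = hyp (there (here refl))
    #2 : ∀ {Γ : List (Formula R n)} {a b c} → (a ∷ b ∷ c ∷ Γ) ⊩ c
    #2 = hyp (there (there (here refl)))
    #3 : ∀ {Γ : List (Formula R n)} {a b c d} → (a ∷ b ∷ c ∷ d ∷ Γ) ⊩ d
    #3 = hyp (there (there (there (here refl))))
    #4 : ∀ {Γ : List (Formula R n)} {a b c d e} → (a ∷ b ∷ c ∷ d ∷ e ∷ Γ) ⊩ e
    #4 = hyp (there (there (there (there (here refl)))))
    #5 : ∀ {Γ : List (Formula R n)} {a b c d e f} → (a ∷ b ∷ c ∷ d ∷ e ∷ f ∷ Γ) ⊩ f
    #5 = hyp (there (there (there (there (there (here refl))))))

  module _ {n : ℕ} {Γ : List (Formula R n)} where

    cast : ∀ {φ ψ} → φ ≡ ψ → Γ ⊩ φ → Γ ⊩ ψ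
    cast = subst (Γ ⊩_)

    weaken₁ : ∀ {φ ψ} → Γ ⊩ φ → (ψ ∷ Γ) ⊩ φ
    weaken₁ = weaken there

    have : ∀ {φ ψ} → Γ ⊩ φ → (φ ∷ Γ) ⊩ ψ → Γ ⊩ ψ
    have d e = ⇒E (⇒I e) d

    ∀E-ext : ∀ {m} {σ : Sub m n} {φ : Formula R (suc m)} → Γ ⊩ substF σ (∀' φ) → (t : Term n) →
             Γ ⊩ substF (ext t σ) φ
    ∀E-ext {σ = σ} {φ} d t = cast (substF-sub0-liftS t σ φ) (∀E d t)

    ∀E₂ : ∀ {φ : Formula R (suc (suc n))} → Γ ⊩ ∀' (∀' φ) → (s t : Term n) →
          Γ ⊩ substF (ext t (sub0 s)) φ
    ∀E₂ d s t = ∀E-ext (∀E d s) t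

    ∀E₃ : ∀ {φ : Formula R (suc (suc (suc n)))} → Γ ⊩ ∀' (∀' (∀' φ)) → (r s t : Term n) →
          Γ ⊩ substF (ext t (ext s (sub0 r))) φ
    ∀E₃ d r s t = ∀E-ext (∀E₂ d r s) t

    ≐-cong : ∀ {s t} (C : Term (suc n)) → Γ ⊩ s ≐ t → Γ ⊩ substT (sub0 s) C ≐ substT (sub0 t) C
    ≐-cong {s} {t} C p =
      cast (cong (_≐ substT (sub0 t) C) (substT-sub0-wkT t (substT (sub0 s) C)))
        (≐subst (wkT (substT (sub0 s) C) ≐ C) p
          (cast (cong (_≐ substT (sub0 s) C) (sym (substT-sub0-wkT s _))) (≐refl _)))

    ≐-sym : ∀ {s t} → Γ ⊩ s ≐ t → Γ ⊩ t ≐ s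
    ≐-sym {s} {t} p =
      cast (cong (t ≐_) (substT-sub0-wkT t s))
        (≐subst (v0 ≐ wkT s) p (cast (cong (s ≐_) (sym (substT-sub0-wkT s s))) (≐refl s)))

    ≐-trans : ∀ {s t u} → Γ ⊩ s ≐ t → Γ ⊩ t ≐ u → Γ ⊩ s ≐ u
    ≐-trans {s} {t} {u} p q =
      cast (cong (_≐ u) (substT-sub0-wkT u s))
        (≐subst (wkT s ≐ v0) q (cast (cong (_≐ t) (sym (substT-sub0-wkT t s))) p))

    ≐-cong-𝐒 : ∀ {a b} → Γ ⊩ a ≐ b → Γ ⊩ 𝐒 a ≐ 𝐒 b
    ≐-cong-𝐒 = ≐-cong (𝐒 v0)

    ≐-cong₂ : ∀ {a a' b b'} (f : Fun 2) → Γ ⊩ a ≐ a' → Γ ⊩ b ≐ b' →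
              Γ ⊩ app f (a ∷ b ∷ []) ≐ app f (a' ∷ b' ∷ [])
    ≐-cong₂ {a} {a'} {b} {b'} f p q = ≐-trans
      (cast (cong₂ (λ u w → app f (a ∷ u ∷ []) ≐ app f (a' ∷ w ∷ []))
                   (substT-sub0-wkT a b) (substT-sub0-wkT a' b))
            (≐-cong (app f (v0 ∷ wkT b ∷ [])) p))
      (cast (cong₂ (λ u w → app f (u ∷ b ∷ []) ≐ app f (w ∷ b' ∷ []))
                   (substT-sub0-wkT b a') (substT-sub0-wkT b' a'))
            (≐-cong (app f (wkT a' ∷ v0 ∷ [])) q))

    ⋁≤-intro : ∀ {f : ℕ → Formula R n} m k → k ≤ m → Γ ⊩ f k → Γ ⊩ ⋁≤ f m
    ⋁≤-intro zero    .zero z≤n d = d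
    ⋁≤-intro (suc m) k     k≤m d with k ≟ suc m
    ... | yes refl = ∨I₂ d
    ... | no  k≢m  = ∨I₁ (⋁≤-intro m k (≤-pred (≤∧≢⇒< k≤m k≢m)) d)

  ⋁≤-elim : ∀ {n} {Γ : List (Formula R n)} {f : ℕ → Formula R n} {χ} m → Γ ⊩ ⋁≤ f m →
            (∀ k → k ≤ m → (f k ∷ Γ) ⊩ χ) → Γ ⊩ χ
  ⋁≤-elim zero    d br = have d (br zero z≤n)
  ⋁≤-elim (suc m) d br =
    ∨E d (⋁≤-elim m #0 (λ k k≤m → weaken (∷⁺ʳ _ there) (br k (m≤n⇒m≤1+n k≤m)))) (br (suc m) ≤-refl)

  ⋁≤-map : ∀ {n} {Γ : List (Formula R n)} {f g : ℕ → Formula R n} m → Γ ⊩ ⋁≤ f m →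
           (∀ k → k ≤ m → (f k ∷ Γ) ⊩ g k) → Γ ⊩ ⋁≤ g m
  ⋁≤-map m d br = ⋁≤-elim m d (λ k k≤m → ⋁≤-intro m k k≤m (br k k≤m))

open Deduction IQplus

private variable
  n : ℕ
  Γ : List (Formula Rel₂ n)
  y : Term n

infix 5 _≼_
_≼_ : ∀ {n} → Term n → Term n → Formula Rel₂ n
a ≼ b = rel rleq (a ∷ b ∷ [])

module _ {n : ℕ} {Γ : List (Formula Rel₂ n)} where

  𝐒-injective : ∀ {a b} → Γ ⊩ 𝐒 a ≐ 𝐒 b → Γ ⊩ a ≐ b
  𝐒-injective {a} {b} d = raa (⇒E (⇒E (∀E₂ (axiom (ax-B b1)) a b) #0) (weaken₁ d))

  𝐒≢𝟎 : ∀ {a χ} → Γ ⊩ 𝐒 a ≐ 𝟎 → Γ ⊩ χ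
  𝐒≢𝟎 {a} d = raa (weaken₁ (⇒E (∀E (axiom (ax-B b2)) a) d))

  ⊕-identityʳ : ∀ x → Γ ⊩ x ⊕ 𝟎 ≐ x
  ⊕-identityʳ = ∀E (axiom (ax-B b3))

  ⊕-suc : ∀ x y → Γ ⊩ x ⊕ 𝐒 y ≐ 𝐒 (x ⊕ y)
  ⊕-suc = ∀E₂ (axiom (ax-B b4))

  ⊗-zeroʳ : ∀ x → Γ ⊩ x ⊗ 𝟎 ≐ 𝟎
  ⊗-zeroʳ = ∀E (axiom (ax-B b5))

  ⊗-suc : ∀ x y → Γ ⊩ x ⊗ 𝐒 y ≐ x ⊗ y ⊕ x
  ⊗-suc = ∀E₂ (axiom (ax-B b6))

  ⊕-assoc : ∀ x y z → Γ ⊩ (x ⊕ y) ⊕ z ≐ x ⊕ (y ⊕ z)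
  ⊕-assoc = ∀E₃ (axiom ax-+assoc)

  ⊗-distribˡ-⊕ : ∀ x y z → Γ ⊩ x ⊗ (y ⊕ z) ≐ x ⊗ y ⊕ x ⊗ z
  ⊗-distribˡ-⊕ = ∀E₃ (axiom ax-distr)

  ⊗-assoc : ∀ x y z → Γ ⊩ (x ⊗ y) ⊗ z ≐ x ⊗ (y ⊗ z)
  ⊗-assoc = ∀E₃ (axiom ax-×assoc)

  ≼-numeral : ∀ m t → Γ ⊩ (t ≼ num m) ⇔' ⋁≤ (λ k → t ≐ num k) m
  ≼-numeral m t = cast (body-≡ _) (∀E-ext {φ = body} (axiom (ax-≤ m)) t)
    where
    body : Formula Rel₂ 1
    body = rel rleq (v0 ∷ num m ∷ []) ⇔' ⋁≤ (λ k → v0 ≐ num k) m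

    body-≡ : (σ : Sub 0 n) →
      substF (ext t σ) body
      ≡ ((t ≼ num m) ⇔' ⋁≤ (λ k → t ≐ num k) m)
    body-≡ σ = cong₂ (λ A B → (A ⇒ B) ∧' (B ⇒ A))
      (cong (t ≼_) (substT-num _ m))
      (trans (substF-⋁≤ _ _ m) (⋁≤-cong (λ k → cong (t ≐_) (substT-num _ k)) m))

  ≼-numeral⇒ : ∀ {t} m → Γ ⊩ t ≼ num m → Γ ⊩ ⋁≤ (λ k → t ≐ num k) m
  ≼-numeral⇒ {t} m = ⇒E (∧E₁ (≼-numeral m t))

  ≼-numeral⇐ : ∀ {t} m k → k ≤ m → Γ ⊩ t ≐ num k → Γ ⊩ t ≼ num m
  ≼-numeral⇐ {t} m k k≤m d = ⇒E (∧E₂ (≼-numeral m t)) (⋁≤-intro m k k≤m d)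

  ≼-respʳ-≐ : ∀ {a b c} → Γ ⊩ a ≼ b → Γ ⊩ b ≐ c → Γ ⊩ a ≼ c
  ≼-respʳ-≐ {a} {b} {c} d p =
    cast (cong (_≼ c) (substT-sub0-wkT c a))
      (≐subst (wkT a ≼ v0) p (cast (cong (_≼ b) (sym (substT-sub0-wkT b a))) d))

Regular : ∀ {n} → Term n → Formula Rel₂ n
Regular c = c ≼ c
  ∧' ∀' (∀' (v1 ≼ v0 ⇒ v0 ≼ wkT (wkT c) ⇒ v1 ≼ wkT (wkT c)))
  ∧' ∀' (𝐒 v0 ≼ wkT c ⇒ v0 ≼ wkT c)
  ∧' ∀' (∀' (v1 ≼ v0 ⇒ 𝐒 v0 ≼ wkT (wkT c) ⇒ 𝐒 v1 ≼ 𝐒 v0))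
  ∧' 𝟎 ≼ c

Hereditary : ∀ {n} → Term n → Formula Rel₂ n
Hereditary y = y ≼ y ∧' ∀' (v0 ≼ wkT y ⇒ Regular v0)

Cut : ∀ {n} → Term n → Formula Rel₂ n
Cut x = ∀' (∀' (v1 ⊕ wkT (wkT x) ≐ v0 ⇒ Hereditary v0 ⇒ wkT (wkT x) ≼ v0))

AddCut : ∀ {n} → Term n → Formula Rel₂ n
AddCut x = Cut x ∧' ∀' (Cut v0 ⇒ Cut (v0 ⊕ wkT x))

MulCut : ∀ {n} → Term n → Formula Rel₂ n
MulCut x = AddCut x ∧' ∀' (AddCut v0 ⇒ AddCut (v0 ⊗ wkT x))

module _ {c : Term n} (reg : Γ ⊩ Regular c) where

  regular-refl : Γ ⊩ c ≼ c
  regular-refl = ∧E₁ reg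

  regular-trans : Γ ⊩ ∀' (∀' (v1 ≼ v0 ⇒ v0 ≼ wkT (wkT c) ⇒ v1 ≼ wkT (wkT c)))
  regular-trans = ∧E₁ (∧E₂ reg)

  regular-pred : Γ ⊩ ∀' (𝐒 v0 ≼ wkT c ⇒ v0 ≼ wkT c)
  regular-pred = ∧E₁ (∧E₂ (∧E₂ reg))

  regular-mono : Γ ⊩ ∀' (∀' (v1 ≼ v0 ⇒ 𝐒 v0 ≼ wkT (wkT c) ⇒ 𝐒 v1 ≼ 𝐒 v0))
  regular-mono = ∧E₁ (∧E₂ (∧E₂ (∧E₂ reg)))

  regular-zero : Γ ⊩ 𝟎 ≼ c
  regular-zero = ∧E₂ (∧E₂ (∧E₂ (∧E₂ reg)))

hereditary⇒regular : Γ ⊩ Hereditary y → Γ ⊩ Regular y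
hereditary⇒regular {y = y} her =
  ⇒E (cast (cong (λ u → y ≼ u ⇒ Regular y) (substT-sub0-wkT y y)) (∀E (∧E₂ her) y)) (∧E₁ her)

hereditary-pred : Γ ⊩ ∀' (Hereditary (𝐒 v0) ⇒ Hereditary v0)
hereditary-pred = ∀I (⇒I (have (⇒E (∀E (regular-pred (hereditary⇒regular #0)) v0) (∧E₁ #0))
  (∧I (regular-refl (⇒E (∀E (∧E₂ #1) v0) #0))
      (∀I (⇒I (⇒E (∀E (∧E₂ #2) v0)
                  (⇒E (⇒E (∀E₂ (regular-trans (hereditary⇒regular #2)) v0 v1) #0) #1)))))))

cut-zero : Γ ⊩ Cut 𝟎
cut-zero = ∀I (∀I (⇒I (⇒I (regular-zero (hereditary⇒regular #0)))))

-- From z + S x = w we get w = S (z + x); hereditariness passes down to z + x, so x ≤ z + x,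
-- and monotonicity of S below the regular element w yields S x ≤ w.
cut-suc : Γ ⊩ ∀' (Cut v0 ⇒ Cut (𝐒 v0))
cut-suc = ∀I (⇒I (∀I (∀I (⇒I (⇒I
  (have (≐-trans (≐-sym #1) (⊕-suc v1 v2))
  (have (≐subst (Hereditary v0) #0 #1)
  (have (⇒E (∀E hereditary-pred (v1 ⊕ v2)) #0)
  (≐subst (𝐒 v3 ≼ v0) (≐-sym #2)
    (⇒E (⇒E (∀E₂ (regular-mono (hereditary⇒regular #1)) v2 (v1 ⊕ v2))
             (⇒E (⇒E (∀E₂ #5 v1 (v1 ⊕ v2)) (≐refl _)) #0))
        (∧E₁ #1)))))))))))

addCut-zero : Γ ⊩ AddCut 𝟎
addCut-zero = ∧I cut-zero (∀I (⇒I (≐subst (Cut v0) (≐-sym (⊕-identityʳ v0)) #0)))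

addCut-suc : Γ ⊩ ∀' (AddCut v0 ⇒ AddCut (𝐒 v0))
addCut-suc = ∀I (⇒I (∧I (⇒E (∀E cut-suc v0) (∧E₁ #0))
  (∀I (⇒I (≐subst (Cut v0) (≐-sym (⊕-suc v0 v1))
             (⇒E (∀E cut-suc (v0 ⊕ v1)) (⇒E (∀E (∧E₂ #1) v0) #0)))))))

addCut-⊕ : Γ ⊩ ∀' (∀' (AddCut v1 ⇒ AddCut v0 ⇒ AddCut (v1 ⊕ v0)))
addCut-⊕ = ∀I (∀I (⇒I (⇒I (∧I (⇒E (∀E (∧E₂ #0) v1) (∧E₁ #1))
  (∀I (⇒I (≐subst (Cut v0) (⊕-assoc v0 v2 v1)
             (⇒E (∀E (∧E₂ #1) (v0 ⊕ v2)) (⇒E (∀E (∧E₂ #2) v0) #0)))))))))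

mulCut-zero : Γ ⊩ MulCut 𝟎
mulCut-zero = ∧I addCut-zero (∀I (⇒I (≐subst (AddCut v0) (≐-sym (⊗-zeroʳ v0)) addCut-zero)))

mulCut-suc : Γ ⊩ ∀' (MulCut v0 ⇒ MulCut (𝐒 v0))
mulCut-suc = ∀I (⇒I (∧I (⇒E (∀E addCut-suc v0) (∧E₁ #0))
  (∀I (⇒I (≐subst (AddCut v0) (≐-sym (⊗-suc v0 v1))
             (⇒E (⇒E (∀E₂ addCut-⊕ (v0 ⊗ v1) v0) (⇒E (∀E (∧E₂ #1) v0) #0)) #0))))))

mulCut-⊕ : Γ ⊩ ∀' (∀' (MulCut v1 ⇒ MulCut v0 ⇒ MulCut (v1 ⊕ v0)))
mulCut-⊕ = ∀I (∀I (⇒I (⇒I (∧I (⇒E (⇒E (∀E₂ addCut-⊕ v1 v0) (∧E₁ #1)) (∧E₁ #0))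
  (∀I (⇒I (≐subst (AddCut v0) (≐-sym (⊗-distribˡ-⊕ v0 v2 v1))
             (⇒E (⇒E (∀E₂ addCut-⊕ (v0 ⊗ v2) (v0 ⊗ v1))
                     (⇒E (∀E (∧E₂ #2) v0) #0))
                 (⇒E (∀E (∧E₂ #1) v0) #0)))))))))

mulCut-⊗ : Γ ⊩ ∀' (∀' (MulCut v1 ⇒ MulCut v0 ⇒ MulCut (v1 ⊗ v0)))
mulCut-⊗ = ∀I (∀I (⇒I (⇒I (∧I (⇒E (∀E (∧E₂ #0) v1) (∧E₁ #1))
  (∀I (⇒I (≐subst (AddCut v0) (⊗-assoc v0 v2 v1)
             (⇒E (∀E (∧E₂ #1) (v0 ⊗ v2)) (⇒E (∀E (∧E₂ #2) v0) #0)))))))))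

mulCut-substT : ∀ {k} (t : Term k) (θ : Sub k n) → (∀ i → Γ ⊩ MulCut (θ i)) → Γ ⊩ MulCut (substT θ t)
mulCut-substT (var i)                   θ h = h i
mulCut-substT (app fzero [])            θ h = mulCut-zero
mulCut-substT (app fsucc (t ∷ []))      θ h = ⇒E (∀E mulCut-suc (substT θ t)) (mulCut-substT t θ h)
mulCut-substT (app fplus (s ∷ t ∷ []))  θ h =
  ⇒E (⇒E (∀E₂ mulCut-⊕ (substT θ s) (substT θ t)) (mulCut-substT s θ h)) (mulCut-substT t θ h)
mulCut-substT (app ftimes (s ∷ t ∷ [])) θ h =
  ⇒E (⇒E (∀E₂ mulCut-⊗ (substT θ s) (substT θ t)) (mulCut-substT s θ h)) (mulCut-substT t θ h)

cut-elim : ∀ {x z w} → Γ ⊩ Cut x → Γ ⊩ z ⊕ x ≐ w → Γ ⊩ Hereditary w → Γ ⊩ x ≼ w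
cut-elim {x = x} {z} {w} c p h = ⇒E (⇒E (cast (cong (λ X → z ⊕ X ≐ w ⇒ Hereditary w ⇒ X ≼ w) x-≡) (∀E₂ c z w)) p) h
  where
  x-≡ : substT (ext w (sub0 z)) (wkT (wkT x)) ≡ x
  x-≡ = trans (substT-∘ (ext w (sub0 z)) (ren suc) (wkT x)) (substT-sub0-wkT z x)

module _ {k : ℕ} where

  numeral-≼-trans : ∀ {a b} → Γ ⊩ a ≼ b → Γ ⊩ b ≼ num k → Γ ⊩ a ≼ num k
  numeral-≼-trans a≼b b≼k =
    ⋁≤-elim k (≼-numeral⇒ k b≼k) λ j j≤k →
      ⋁≤-elim j (≼-numeral⇒ j (≼-respʳ-≐ (weaken₁ a≼b) #0)) λ i i≤j →
        ≼-numeral⇐ k i (≤-trans i≤j j≤k) #0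

  numeral-≼-pred : ∀ {a} → Γ ⊩ 𝐒 a ≼ num k → Γ ⊩ a ≼ num k
  numeral-≼-pred Sa≼k = ⋁≤-elim k (≼-numeral⇒ k Sa≼k) λ
    { zero    _    → 𝐒≢𝟎 #0
    ; (suc j) j<k → ≼-numeral⇐ k j (≤-trans (n≤1+n j) j<k) (𝐒-injective #0) }

  numeral-≼-mono : ∀ {a b} → Γ ⊩ a ≼ b → Γ ⊩ 𝐒 b ≼ num k → Γ ⊩ 𝐒 a ≼ 𝐒 b
  numeral-≼-mono a≼b Sb≼k = ⋁≤-elim k (≼-numeral⇒ k Sb≼k) λ
    { zero    _ → 𝐒≢𝟎 #0
    ; (suc j) _ →
        have (𝐒-injective #0) (⋁≤-elim j (≼-numeral⇒ j (≼-respʳ-≐ (weaken₁ (weaken₁ a≼b)) #0)) λ i i≤j →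
          ≼-respʳ-≐ (≼-numeral⇐ (suc j) (suc i) (s≤s i≤j) (≐-cong-𝐒 #0)) (≐-cong-𝐒 (≐-sym #1))) }

  wkT²-num : ∀ {n} → wkT (wkT {n} (num k)) ≡ num k
  wkT²-num = trans (cong wkT (substT-num _ k)) (substT-num _ k)

  regular-numeral : Γ ⊩ Regular (num k)
  regular-numeral = ∧I (≼-numeral⇐ k k ≤-refl (≐refl _))
    (∧I (∀I (∀I (⇒I (⇒I (cast (cong (v1 ≼_) (sym wkT²-num))
                               (numeral-≼-trans #1 (cast (cong (v0 ≼_) wkT²-num) #0)))))))
    (∧I (∀I (⇒I (cast (cong (v0 ≼_) (sym (substT-num _ k)))
                      (numeral-≼-pred (cast (cong (𝐒 v0 ≼_) (substT-num _ k)) #0)))))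
    (∧I (∀I (∀I (⇒I (⇒I (numeral-≼-mono #1 (cast (cong (𝐒 v0 ≼_) wkT²-num) #0))))))
        (≼-numeral⇐ k 0 z≤n (≐refl 𝟎)))))

hereditary-numeral : ∀ k → Γ ⊩ Hereditary (num k)
hereditary-numeral k = ∧I (≼-numeral⇐ k k ≤-refl (≐refl _)) (∀I (⇒I
  (⋁≤-elim k (≼-numeral⇒ k (cast (cong (v0 ≼_) (substT-num _ k)) #0)) λ j _ →
    ≐subst (Regular v0) (≐-sym #0) (regular-numeral {k = j}))))

graph : Fun 2 → Formula Rel₂ 3
graph f = v0 ≐ app f (v1 ∷ v2 ∷ [])

𝕀 : Translation
𝕀 = record
  { dim = 1 ; dim≥1 = s≤s z≤n ; δ = MulCut v0
  ; E = v1 ≐ v0 ; Fz = v0 ≐ 𝟎 ; FS = v0 ≐ 𝐒 v1 ; Fp = graph fplus ; Ft = graph ftimes }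

open Translate 𝕀

ι : ∀ {n} → Fin n → Fin (n * 1)
ι i = combine i zero

-- The renaming performed by Blocks.inst, so that lemmas about blockRen apply to
-- translated formulas up to definitional equality.
blockRen : ∀ {k m} → (Fin k → Fin m) → Fin (k * 1) → Fin (m * 1)
blockRen {k} f v = let (b , j) = remQuot {k} 1 v in combine (f b) j

blockRen-ι : ∀ {k m} (f : Fin k → Fin m) b → blockRen f (ι b) ≡ ι (f b)
blockRen-ι f b = cong (λ p → combine (f (proj₁ p)) (proj₂ p)) (remQuot-combine b zero)

env : ∀ {k} → Sub (suc k * 1) n → Sub k n
env σ i = σ (ι (suc i))

shift₂ : ∀ {k} → Fin k → Fin (suc (suc k) * 1)
shift₂ i = suc (suc (ι i))

shift₃ : ∀ {k} → Fin k → Fin (suc (suc (suc k)) * 1)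
shift₃ i = suc (suc (suc (ι i)))

blockRen-shift₂ : ∀ k (i : Fin k) → blockRen {k} (λ b → suc (suc b)) (ι i) ≡ shift₂ i
blockRen-shift₂ k = blockRen-ι (λ b → suc (suc b))

blockRen-shift₃ : ∀ k (i : Fin k) → blockRen {k} (λ b → suc (suc (suc b))) (ι i) ≡ shift₃ i
blockRen-shift₃ k = blockRen-ι (λ b → suc (suc (suc b)))

mutual
  Val-elim : ∀ {k} (t : Term k) (σ : Sub (suc k * 1) n) →
             Γ ⊩ substF σ (Val t) → Γ ⊩ σ zero ≐ substT (env σ) t
  Val-elim (var i)                   σ d = ∧E₁ d
  Val-elim (app fzero [])            σ d = d
  Val-elim {k = k} (app fsucc (t ∷ [])) σ d = ∃E d (≐-trans (∧E₂ (∧E₂ #0))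
    (≐-cong-𝐒 (cast (cong (v0 ≐_) (sym (wkT-substT (env σ) t)))
                    (Val-elim-ren t (liftS σ) shift₂ (blockRen-shift₂ k) (∧E₁ (∧E₂ #0))))))
  Val-elim (app fplus (s ∷ t ∷ []))  σ d = valBin-elim fplus s t σ d
  Val-elim (app ftimes (s ∷ t ∷ [])) σ d = valBin-elim ftimes s t σ d

  Val-elim-ren : ∀ {k K} (t : Term k) (σ : Sub K n) {ρ : Fin (suc k * 1) → Fin K} (h : Fin k → Fin K) →
                 (∀ i → ρ (ι (suc i)) ≡ h i) → Γ ⊩ substF σ (renameF ρ (Val t)) →
                 Γ ⊩ σ (ρ zero) ≐ substT (λ i → σ (h i)) t
  Val-elim-ren t σ {ρ} h e d =
    cast (cong (_ ≐_) (substT-cong (λ i → cong σ (e i)) t))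
      (Val-elim t (σ ∘ˢ ren ρ) (cast (substF-∘ σ (ren ρ) (Val t)) d))

  valBin-elim : ∀ {k} (f : Fun 2) (s t : Term k) (σ : Sub (suc k * 1) n) →
                Γ ⊩ substF σ (valBin {k} (graph f) (Val s) (Val t)) →
                Γ ⊩ σ zero ≐ substT (env σ) (app f (s ∷ t ∷ []))
  valBin-elim {k = k} f s t σ d = ∃E d (∃E #0 (≐-trans (∧E₂ (∧E₂ (∧E₂ (∧E₂ #0))))
    (≐-cong₂ f (cast (cong (v1 ≐_) (sym (wkT²-substT (env σ) s)))
                     (Val-elim-ren s (liftS (liftS σ)) shift₃ (blockRen-shift₃ k) (∧E₁ (∧E₂ (∧E₂ #0)))))
               (cast (cong (v0 ≐_) (sym (wkT²-substT (env σ) t)))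
                     (Val-elim-ren t (liftS (liftS σ)) shift₃ (blockRen-shift₃ k) (∧E₁ (∧E₂ (∧E₂ (∧E₂ #0)))))))))

δ-intro : ∀ m (τs : Subs (m * 1) n) {θ : Sub (m * 1) n} → ⟦ τs ⟧ˢ ≗ θ → (b : Fin m) →
          Γ ⊩ MulCut (θ (ι b)) → Γ ⊩ substF* τs (δat m b)
δ-intro m τs e b d = cast (sym (substF*-ren τs e (blockRen {1} (λ _ → b)) (MulCut v0))) d

mutual
  Val-intro : ∀ {k} (t : Term k) (σ : Sub (suc k * 1) n) → (∀ (i : Fin k) → Γ ⊩ MulCut (env σ i)) →
              Γ ⊩ σ zero ≐ substT (env σ) t → Γ ⊩ substF σ (Val t)
  Val-intro (var i)                   σ h p = ∧I p (⇒I #0)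
  Val-intro (app fzero [])            σ h p = p
  Val-intro {k = k} (app fsucc (t ∷ [])) σ h p =
    ∃I u (∧I (δ-intro (suc (suc k)) τs (sub0-∘-liftS u σ) zero (mulCut-substT t (env σ) h))
         (∧I (Val-intro-ren t τs (sub0-∘-liftS u σ) shift₂ (blockRen-shift₂ k) h (≐refl u))
             (cast (cong (_≐ 𝐒 u) (sym (substT-sub0-wkT u (σ zero)))) p)))
    where
    u : Term _
    u = substT (env σ) t
    τs : Subs (suc (suc k) * 1) _
    τs = sub0 u ◁ liftS σ ◁ ε
  Val-intro (app fplus (s ∷ t ∷ []))  σ h p = valBin-intro fplus s t σ h p
  Val-intro (app ftimes (s ∷ t ∷ [])) σ h p = valBin-intro ftimes s t σ h p

  Val-intro-ren : ∀ {k K} (t : Term k) (τs : Subs K n) {θ : Sub K n} → ⟦ τs ⟧ˢ ≗ θ →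
                  {ρ : Fin (suc k * 1) → Fin K} (h : Fin k → Fin K) → (∀ i → ρ (ι (suc i)) ≡ h i) →
                  (∀ i → Γ ⊩ MulCut (θ (h i))) → Γ ⊩ θ (ρ zero) ≐ substT (λ i → θ (h i)) t →
                  Γ ⊩ substF* τs (renameF ρ (Val t))
  Val-intro-ren {Γ = Γ} t τs {θ} E {ρ} h e doms p =
    cast (sym (substF*-ren τs E ρ (Val t)))
      (Val-intro t (θ ∘ˢ ren ρ) (λ i → subst (λ x → Γ ⊩ MulCut (θ x)) (sym (e i)) (doms i))
        (cast (cong (_ ≐_) (sym (substT-cong (λ i → cong θ (e i)) t))) p))

  valBin-intro : ∀ {k} (f : Fun 2) (s t : Term k) (σ : Sub (suc k * 1) n) →
                 (∀ (i : Fin k) → Γ ⊩ MulCut (env σ i)) →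
                 Γ ⊩ σ zero ≐ substT (env σ) (app f (s ∷ t ∷ [])) →
                 Γ ⊩ substF σ (valBin {k} (graph f) (Val s) (Val t))
  valBin-intro {k = k} f s t σ h p =
    ∃I u₁ (∃I u₂
      (∧I (δ-intro (suc (suc (suc k))) τs E (suc zero) (mulCut-substT s (env σ) h))
      (∧I (δ-intro (suc (suc (suc k))) τs E zero (mulCut-substT t (env σ) h))
      (∧I (Val-intro-ren s τs E shift₃ (blockRen-shift₃ k) h (≐refl u₁))
      (∧I (Val-intro-ren t τs E shift₃ (blockRen-shift₃ k) h (≐refl u₂))
          (cast (sym (cong₂ (λ a b → a ≐ app f (b ∷ u₂ ∷ [])) (E (suc (suc zero))) (E (suc zero)))) p))))))
    where
    u₁ u₂ : Term _
    u₁ = substT (env σ) s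
    u₂ = substT (env σ) t
    τs : Subs (suc (suc (suc k)) * 1) _
    τs = sub0 u₂ ◁ liftS (sub0 u₁) ◁ liftS (liftS σ) ◁ ε
    E : ⟦ τs ⟧ˢ ≗ ext u₂ (ext u₁ σ)
    E = ⟦sub0◁liftS²⟧ u₁ u₂ σ

atom-elim : ∀ {k} (s t : Term k) (σ : Sub (k * 1) n) → Γ ⊩ substF σ (τ (s ≐ t)) →
            Γ ⊩ substT (λ i → σ (ι i)) s ≐ substT (λ i → σ (ι i)) t
atom-elim {k = k} s t σ d = ∃E d (∃E #0 (cast (cong₂ _≐_ (sym (wkT²-substT θ s)) (sym (wkT²-substT θ t)))
  (≐-trans (≐-sym (Val-elim-ren s (liftS (liftS σ)) shift₂ (blockRen-shift₂ k) (∧E₁ (∧E₂ (∧E₂ #0)))))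
  (≐-trans (≐-sym (∧E₂ (∧E₂ (∧E₂ (∧E₂ #0)))))
           (Val-elim-ren t (liftS (liftS σ)) shift₂ (blockRen-shift₂ k) (∧E₁ (∧E₂ (∧E₂ (∧E₂ #0)))))))))
  where
  θ : Sub _ _
  θ i = σ (ι i)

atom-intro : ∀ {k} (s t : Term k) (σ : Sub (k * 1) n) → (∀ (i : Fin k) → Γ ⊩ MulCut (σ (ι i))) →
             Γ ⊩ substT (λ i → σ (ι i)) s ≐ substT (λ i → σ (ι i)) t → Γ ⊩ substF σ (τ (s ≐ t))
atom-intro {k = k} s t σ h p =
  ∃I u₁ (∃I u₂
    (∧I (δ-intro (suc (suc k)) τs E (suc zero) (mulCut-substT s θ h))
    (∧I (δ-intro (suc (suc k)) τs E zero (mulCut-substT t θ h))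
    (∧I (Val-intro-ren s τs E shift₂ (blockRen-shift₂ k) h (≐refl u₁))
    (∧I (Val-intro-ren t τs E shift₂ (blockRen-shift₂ k) h (≐refl u₂))
        (cast (cong (u₂ ≐_) (sym (E (suc zero)))) (≐-sym p)))))))
  where
  θ : Sub k _
  θ i = σ (ι i)
  u₁ u₂ : Term _
  u₁ = substT θ s
  u₂ = substT θ t
  τs : Subs (suc (suc k) * 1) _
  τs = sub0 u₂ ◁ liftS (sub0 u₁) ◁ liftS (liftS σ) ◁ ε
  E : ⟦ τs ⟧ˢ ≗ ext u₂ (ext u₁ σ)
  E = ⟦sub0◁liftS²⟧ u₁ u₂ σ

τ≐-elim : ∀ k {Γ : List (Formula Rel₂ (k * 1))} (s t : Term k) → Γ ⊩ τ (s ≐ t) →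
          Γ ⊩ substT (λ i → var (ι i)) s ≐ substT (λ i → var (ι i)) t
τ≐-elim k s t d = atom-elim s t var (cast (sym (substF-id _)) d)

τ≐-intro : ∀ k {Γ : List (Formula Rel₂ (k * 1))} (s t : Term k) → (∀ i → Γ ⊩ MulCut (var (ι i))) →
           Γ ⊩ substT (λ i → var (ι i)) s ≐ substT (λ i → var (ι i)) t → Γ ⊩ τ (s ≐ t)
τ≐-intro k s t h p = cast (substF-id _) (atom-intro s t var h p)

τ-⋁≤ : ∀ {k} (f : ℕ → Formula Rel₁ k) m → τ (⋁≤ f m) ≡ ⋁≤ (λ j → τ (f j)) m
τ-⋁≤ f zero    = refl
τ-⋁≤ f (suc m) = cong (_∨' τ (f (suc m))) (τ-⋁≤ f m)

τ-≤ₗ-schema : ∀ m → IQplus ⊢ τ {0} (∀' (∃' (v0 ⊕ v1 ≐ num m) ⇒ ⋁≤ (λ k → v0 ≐ num k) m))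
τ-≤ₗ-schema m = ∀I (⇒I (⇒I (cast (sym (τ-⋁≤ (λ k → v0 ≐ num k) m))
  (∃E #0 (cast (sym (substF-⋁≤ (ren suc) (λ k → τ {1} (v0 ≐ num k)) m))
    (have (cast (cong (v0 ⊕ v1 ≐_) (substT-num _ m)) (τ≐-elim 2 (v0 ⊕ v1) (num m) (∧E₂ #0)))
      (⋁≤-map m (≼-numeral⇒ m (cut-elim (∧E₁ (∧E₁ #3)) #0 (hereditary-numeral m)))
        λ k _ → atom-intro {k = 1} v0 (num k) (ren suc) (λ { zero → #4 })
                  (cast (cong (v1 ≐_) (sym (substT-num _ k))) #0))))))))

τ-B : ∀ {φ} → B φ → IQplus ⊢ τ φ
τ-B b1 = ∀I (⇒I (∀I (⇒I (⇒I (⇒I (⇒E #1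
  (τ≐-intro 2 v1 v0 (λ { zero → #2 ; (suc zero) → #3 })
    (𝐒-injective (τ≐-elim 2 (𝐒 v1) (𝐒 v0) #0)))))))))
τ-B b2 = ∀I (⇒I (⇒I (𝐒≢𝟎 (τ≐-elim 1 (𝐒 v0) 𝟎 #0))))
τ-B b3 = ∀I (⇒I (τ≐-intro 1 (v0 ⊕ 𝟎) v0 (λ { zero → #0 }) (⊕-identityʳ v0)))
τ-B b4 = ∀I (⇒I (∀I (⇒I (τ≐-intro 2 (v1 ⊕ 𝐒 v0) (𝐒 (v1 ⊕ v0))
  (λ { zero → #0 ; (suc zero) → #1 }) (⊕-suc v1 v0)))))
τ-B b5 = ∀I (⇒I (τ≐-intro 1 (v0 ⊗ 𝟎) 𝟎 (λ { zero → #0 }) (⊗-zeroʳ v0)))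
τ-B b6 = ∀I (⇒I (∀I (⇒I (τ≐-intro 2 (v1 ⊗ 𝐒 v0) (v1 ⊗ v0 ⊕ v1)
  (λ { zero → #0 ; (suc zero) → #1 }) (⊗-suc v1 v0)))))

τ-IQstar : ∀ φ → IQstar φ → IQplus ⊢ τ φ
τ-IQstar _ (ax-B b) = τ-B b
τ-IQstar _ (ax-≤ m) = τ-≤ₗ-schema m

τ-congruence : ∀ f → IQplus ⊢ τ {0} (∀' (∀' (∀' (∀'
                 (v3 ≐ v2 ⇒ v1 ≐ v0 ⇒ app f (v3 ∷ v1 ∷ []) ≐ app f (v2 ∷ v0 ∷ []))))))
τ-congruence f = ∀I (⇒I (∀I (⇒I (∀I (⇒I (∀I (⇒I (⇒I (⇒I
  (τ≐-intro 4 (app f (v3 ∷ v1 ∷ [])) (app f (v2 ∷ v0 ∷ []))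
    (λ { zero → #2 ; (suc zero) → #3 ; (suc (suc zero)) → #4 ; (suc (suc (suc zero))) → #5 })
    (≐-cong₂ f (τ≐-elim 4 v3 v2 #1) (τ≐-elim 4 v1 v0 #0))))))))))))

τ-EqAx : ∀ φ → EqAx φ → IQplus ⊢ τ φ
τ-EqAx _ eq-refl  = ∀I (⇒I (τ≐-intro 1 v0 v0 (λ { zero → #0 }) (≐refl v0)))
τ-EqAx _ eq-sym   = ∀I (⇒I (∀I (⇒I (⇒I (τ≐-intro 2 v0 v1 (λ { zero → #1 ; (suc zero) → #2 })
  (≐-sym (τ≐-elim 2 v1 v0 #0)))))))
τ-EqAx _ eq-trans = ∀I (⇒I (∀I (⇒I (∀I (⇒I (⇒I (⇒I
  (τ≐-intro 3 v2 v0 (λ { zero → #2 ; (suc zero) → #3 ; (suc (suc zero)) → #4 })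
    (≐-trans (τ≐-elim 3 v2 v1 #1) (τ≐-elim 3 v1 v0 #0))))))))))
τ-EqAx _ eq-S     = ∀I (⇒I (∀I (⇒I (⇒I (τ≐-intro 2 (𝐒 v1) (𝐒 v0) (λ { zero → #1 ; (suc zero) → #2 })
  (≐-cong-𝐒 (τ≐-elim 2 v1 v0 #0)))))))
τ-EqAx _ eq-+     = τ-congruence fplus
τ-EqAx _ eq-×     = τ-congruence ftimes

graph-total : ∀ f → (∀ {n} {Γ : List (Formula Rel₂ n)} →
                 Γ ⊩ ∀' (∀' (MulCut v1 ⇒ MulCut v0 ⇒ MulCut (app f (v1 ∷ v0 ∷ []))))) →
        IQplus ⊢ totBin (graph f)
graph-total f closed = ∀I (∀I (⇒I (∃I (app f (v1 ∷ v0 ∷ []))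
  (∧I (⇒E (⇒E (∀E₂ closed v1 v0) (∧E₁ #0)) (∧E₂ #0)) (≐refl _)))))

graph-unique : ∀ f → IQplus ⊢ uniqBin (graph f)
graph-unique f = ∀I (∀I (∀I (∀I (⇒I
  (≐-trans (∧E₂ (∧E₂ (∧E₂ (∧E₂ (∧E₂ #0))))) (≐-sym (∧E₁ (∧E₂ (∧E₂ (∧E₂ (∧E₂ #0)))))))))))

𝕀-interprets : IsInterpretation IQstar IQplus 𝕀
𝕀-interprets = record
  { nonempty = ∃I 𝟎 mulCut-zero
  ; tot-0    = ∃I 𝟎 (∧I mulCut-zero (≐refl 𝟎))
  ; uniq-0   = ∀I (∀I (⇒I (≐-trans (∧E₂ (∧E₂ (∧E₂ #0))) (≐-sym (∧E₁ (∧E₂ (∧E₂ #0)))))))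
  ; tot-S    = ∀I (⇒I (∃I (𝐒 v0) (∧I (⇒E (∀E mulCut-suc v0) #0) (≐refl _))))
  ; uniq-S   = ∀I (∀I (∀I (⇒I (≐-trans (∧E₂ (∧E₂ (∧E₂ (∧E₂ #0)))) (≐-sym (∧E₁ (∧E₂ (∧E₂ (∧E₂ #0)))))))))
  ; tot-+    = graph-total fplus mulCut-⊕
  ; uniq-+   = graph-unique fplus
  ; tot-×    = graph-total ftimes mulCut-⊗
  ; uniq-×   = graph-unique ftimes
  ; axioms   = τ-IQstar
  ; equality = τ-EqAx
  }

mainTheorem14 : Interpretable IQstar IQplus
mainTheorem14 = 𝕀 , 𝕀-interprets
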